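{- A pseudo-hoop $A$ is a Wajsberg pseudo-hoop if and only if the set of type I state operators on $A$ equals the set of type II state operators on $A$.
   Context: A pseudo-hoop is an algebra $(A,\odot,\rightarrow,\rightsquigarrow,1)$ of type $(2,2,2,0)$ such that for all $x,y,z\in A$: $x\odot 1=1\odot x=x$; $x\rightarrow x=x\rightsquigarrow x=1$; $(x\odot y)\rightarrow z=x\rightarrow(y\rightarrow z)$; $(x\odot y)\rightsquigarrow z=y\rightsquigarrow(x\rightsquigarrow z)$; $(x\rightarrow y)\odot x=(y\rightarrow x)\odot y=x\odot(x\rightsquigarrow y)=y\odot(y\rightsquigarrow x)$. Put $x\vee_1 y=(x\rightarrow y)\rightsquigarrow y$, $x\vee_2 y=(x\rightsquigarrow y)\rightarrow y$. $A$ is Wajsberg if $x\vee_1 y=y\vee_1 x$ and $x\vee_2 y=y\vee_2 x$ for all $x,y$. For a map $\mu:A\to A$ consider, for all $x,y\in A$: (IS1) $\mu(x\rightarrow y)=\mu(x\vee_1 y)\rightarrow\mu(y)$ and $\mu(x\rightsquigarrow y)=\mu(x\vee_2 y)\rightsquigarrow\mu(y)$; (IS1') $\mu(x\rightarrow y)=\mu(y\vee_1 x)\rightarrow\mu(y)$ and $\mu(x\rightsquigarrow y)=\mu(y\vee_2 x)\rightsquigarrow\mu(y)$; (IS2) $\mu(x\odot y)=\mu(x)\odot\mu(x\rightsquigarrow x\odot y)=\mu(y\rightarrow x\odot y)\odot\mu(y)$; (IS3) $\mu(\mu(x)\odot\mu(y))=\mu(x)\odot\mu(y)$; (IS4) $\mu(\mu(x)\rightarrow\mu(y))=\mu(x)\rightarrow\mu(y)$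 and $\mu(\mu(x)\rightsquigarrow\mu(y))=\mu(x)\rightsquigarrow\mu(y)$. $\mu$ is a type I state operator if it satisfies (IS1),(IS2),(IS3),(IS4), and a type II state operator if it satisfies (IS1'),(IS2),(IS3),(IS4). -}

module Defs where

open import Level using (Level; suc; _⊔_)
open import Relation.Binary.PropositionalEquality using (_≡_)
open import Data.Product using (_×_)

record PseudoHoop (ℓ : Level) : Set (suc ℓ) where
  infixl 7 _⊙_
  infixr 5 _⇒_ _⇝_
  field
    Carrier : Set ℓ
    _⊙_ : Carrier → Carrier → Carrier
    _⇒_ : Carrier → Carrier → Carrier
    _⇝_ : Carrier → Carrier → Carrier
    one : Carrier
    ⊙-identityʳ : ∀ x → x ⊙ one ≡ x
    ⊙-identityˡ : ∀ x → one ⊙ x ≡ x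
    ⇒-refl : ∀ x → x ⇒ x ≡ one
    ⇝-refl : ∀ x → x ⇝ x ≡ one
    ⇒-curry : ∀ x y z → (x ⊙ y) ⇒ z ≡ x ⇒ (y ⇒ z)
    ⇝-curry : ∀ x y z → (x ⊙ y) ⇝ z ≡ y ⇝ (x ⇝ z)
    div₁ : ∀ x y → (x ⇒ y) ⊙ x ≡ (y ⇒ x) ⊙ y
    div₂ : ∀ x y → (y ⇒ x) ⊙ y ≡ x ⊙ (x ⇝ y)
    div₃ : ∀ x y → x ⊙ (x ⇝ y) ≡ y ⊙ (y ⇝ x)

  _∨₁_ : Carrier → Carrier → Carrier
  x ∨₁ y = (x ⇒ y) ⇝ y

  _∨₂_ : Carrier → Carrier → Carrier
  x ∨₂ y = (x ⇝ y) ⇒ y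

module _ {ℓ : Level} (A : PseudoHoop ℓ) where
  open PseudoHoop A

  IsWajsberg : Set ℓ
  IsWajsberg = (∀ x y → x ∨₁ y ≡ y ∨₁ x) × (∀ x y → x ∨₂ y ≡ y ∨₂ x)

  IS1 : (Carrier → Carrier) → Set ℓ
  IS1 μ = ∀ x y → (μ (x ⇒ y) ≡ μ (x ∨₁ y) ⇒ μ y) × (μ (x ⇝ y) ≡ μ (x ∨₂ y) ⇝ μ y)

  IS1' : (Carrier → Carrier) → Set ℓ
  IS1' μ = ∀ x y → (μ (x ⇒ y) ≡ μ (y ∨₁ x) ⇒ μ y) × (μ (x ⇝ y) ≡ μ (y ∨₂ x) ⇝ μ y)

  IS2 : (Carrier → Carrier) → Set ℓ
  IS2 μ = ∀ x y → (μ (x ⊙ y) ≡ μ x ⊙ μ (x ⇝ x ⊙ y))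
                × (μ (x ⊙ y) ≡ μ (y ⇒ x ⊙ y) ⊙ μ y)

  IS3 : (Carrier → Carrier) → Set ℓ
  IS3 μ = ∀ x y → μ (μ x ⊙ μ y) ≡ μ x ⊙ μ y

  IS4 : (Carrier → Carrier) → Set ℓ
  IS4 μ = ∀ x y → (μ (μ x ⇒ μ y) ≡ μ x ⇒ μ y) × (μ (μ x ⇝ μ y) ≡ μ x ⇝ μ y)

  IsTypeIStateOperator : (Carrier → Carrier) → Set ℓ
  IsTypeIStateOperator μ = IS1 μ × IS2 μ × IS3 μ × IS4 μ

  IsTypeIIStateOperator : (Carrier → Carrier) → Set ℓ
  IsTypeIIStateOperator μ = IS1' μ × IS2 μ × IS3 μ × IS4 μ

module Submission where

open import Defs
open import Level using (Level)
open import Function.Base using (id)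
open import Function.Bundles using (_⇔_; mk⇔; Equivalence)
open import Relation.Binary.PropositionalEquality
open import Data.Product using (_,_; proj₁; proj₂; map₁)

-- In a Wajsberg pseudo-hoop the joins in (IS1) and (IS1') coincide, so the two
-- kinds of state operator are the same. Conversely, the identity map is always a
-- type I state operator, because ((x → y) ⇝ y) → y = x → y. If it is also of type
-- II, then x → y = (y ∨₁ x) → y, hence x ∨₁ y = ((y ∨₁ x) → y) ⇝ y ≥ y ∨₁ x;
-- by symmetry ∨₁ is commutative, and likewise ∨₂.

module PseudoHoopProperties {ℓ : Level} (A : PseudoHoop ℓ) where
  open PseudoHoop A
  open ≡-Reasoning

  infix 4 _≤_
  _≤_ : Carrier → Carrier → Set ℓ
  x ≤ y = x ⇒ y ≡ one

  ≤-antisym : ∀ {x y} → x ≤ y → y ≤ x → x ≡ y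
  ≤-antisym {x} {y} x≤y y≤x = begin
    x           ≡⟨ sym (⊙-identityˡ x) ⟩
    one ⊙ x     ≡⟨ cong (_⊙ x) (sym x≤y) ⟩
    (x ⇒ y) ⊙ x ≡⟨ div₁ x y ⟩
    (y ⇒ x) ⊙ y ≡⟨ cong (_⊙ y) y≤x ⟩
    one ⊙ y     ≡⟨ ⊙-identityˡ y ⟩
    y           ∎

  ⇒-injective : ∀ {x y} → (∀ z → x ⇒ z ≡ y ⇒ z) → x ≡ y
  ⇒-injective {x} {y} eq =
    ≤-antisym (trans (eq y) (⇒-refl y)) (trans (sym (eq x)) (⇒-refl x))

  ⊙-assoc : ∀ x y z → x ⊙ (y ⊙ z) ≡ (x ⊙ y) ⊙ z
  ⊙-assoc x y z = ⇒-injective λ w → begin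
    (x ⊙ (y ⊙ z)) ⇒ w   ≡⟨ ⇒-curry x (y ⊙ z) w ⟩
    x ⇒ ((y ⊙ z) ⇒ w)   ≡⟨ cong (x ⇒_) (⇒-curry y z w) ⟩
    x ⇒ (y ⇒ (z ⇒ w))   ≡⟨ sym (⇒-curry x y (z ⇒ w)) ⟩
    (x ⊙ y) ⇒ (z ⇒ w)   ≡⟨ sym (⇒-curry (x ⊙ y) z w) ⟩
    ((x ⊙ y) ⊙ z) ⇒ w   ∎

  ⇒-absorb : ∀ {x y} → (x ⇒ y) ⊙ x ≡ x → x ≤ y
  ⇒-absorb {x} {y} eq = begin
    x ⇒ y                 ≡⟨ cong (_⇒ y) (sym eq) ⟩
    ((x ⇒ y) ⊙ x) ⇒ y     ≡⟨ ⇒-curry (x ⇒ y) x y ⟩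
    (x ⇒ y) ⇒ (x ⇒ y)     ≡⟨ ⇒-refl (x ⇒ y) ⟩
    one                   ∎

  ⇝-absorb : ∀ {x y} → x ⊙ (x ⇝ y) ≡ x → x ⇝ y ≡ one
  ⇝-absorb {x} {y} eq = begin
    x ⇝ y                 ≡⟨ cong (_⇝ y) (sym eq) ⟩
    (x ⊙ (x ⇝ y)) ⇝ y     ≡⟨ ⇝-curry x (x ⇝ y) y ⟩
    (x ⇝ y) ⇝ (x ⇝ y)     ≡⟨ ⇝-refl (x ⇝ y) ⟩
    one                   ∎

  one⇒x≡x : ∀ x → one ⇒ x ≡ x
  one⇒x≡x x = ≤-antisym one⇒x≤x x≤one⇒x
    where
    one⇒x≤x : one ⇒ x ≤ x
    one⇒x≤x = trans (cong (_⇒ x) (sym (⊙-identityʳ (one ⇒ x))))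
                    (trans (⇒-curry (one ⇒ x) one x) (⇒-refl (one ⇒ x)))
    x≤one⇒x : x ≤ one ⇒ x
    x≤one⇒x = trans (sym (⇒-curry x one x)) (trans (cong (_⇒ x) (⊙-identityʳ x)) (⇒-refl x))

  x≤one : ∀ x → x ≤ one
  x≤one x = ⇒-absorb (trans (div₁ x one) (trans (⊙-identityʳ (one ⇒ x)) (one⇒x≡x x)))

  ≤⇒⇒⊙≡ : ∀ {x y} → x ≤ y → (y ⇒ x) ⊙ y ≡ x
  ≤⇒⇒⊙≡ {x} {y} x≤y = trans (sym (div₁ x y)) (trans (cong (_⊙ x) x≤y) (⊙-identityˡ x))

  ≤⇒⊙⇝≡ : ∀ {x y} → x ≤ y → y ⊙ (y ⇝ x) ≡ x
  ≤⇒⊙⇝≡ {x} {y} x≤y = trans (sym (div₂ y x)) (trans (cong (_⊙ x) x≤y) (⊙-identityˡ x))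

  ≤⇒⇝≡one : ∀ {x y} → x ≤ y → x ⇝ y ≡ one
  ≤⇒⇝≡one {x} {y} x≤y = ⇝-absorb (trans (div₃ x y) (≤⇒⊙⇝≡ x≤y))

  ⇝≡one⇒≤ : ∀ {x y} → x ⇝ y ≡ one → x ≤ y
  ⇝≡one⇒≤ {x} {y} eq = ⇒-absorb (begin
    (x ⇒ y) ⊙ x    ≡⟨ div₂ y x ⟩
    y ⊙ (y ⇝ x)    ≡⟨ sym (div₃ x y) ⟩
    x ⊙ (x ⇝ y)    ≡⟨ cong (x ⊙_) eq ⟩
    x ⊙ one        ≡⟨ ⊙-identityʳ x ⟩
    x              ∎)

  ≤-trans : ∀ {x y z} → x ≤ y → y ≤ z → x ≤ z
  ≤-trans {x} {y} {z} x≤y y≤z = begin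
    x ⇒ z                 ≡⟨ cong (_⇒ z) (sym (≤⇒⇒⊙≡ x≤y)) ⟩
    ((y ⇒ x) ⊙ y) ⇒ z     ≡⟨ ⇒-curry (y ⇒ x) y z ⟩
    (y ⇒ x) ⇒ (y ⇒ z)     ≡⟨ cong ((y ⇒ x) ⇒_) y≤z ⟩
    (y ⇒ x) ⇒ one         ≡⟨ x≤one (y ⇒ x) ⟩
    one                   ∎

  x⊙y≤y : ∀ x y → x ⊙ y ≤ y
  x⊙y≤y x y = trans (⇒-curry x y y) (trans (cong (x ⇒_) (⇒-refl y)) (x≤one x))

  x⊙y≤x : ∀ x y → x ⊙ y ≤ x
  x⊙y≤x x y =
    ⇝≡one⇒≤ (trans (⇝-curry x y x) (trans (cong (y ⇝_) (⇝-refl x)) (≤⇒⇝≡one (x≤one y))))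

  ⇒-mp : ∀ x y → (x ⇒ y) ⊙ x ≤ y
  ⇒-mp x y = subst (_≤ y) (sym (div₁ x y)) (x⊙y≤y (y ⇒ x) y)

  ⇝-mp : ∀ x y → x ⊙ (x ⇝ y) ≤ y
  ⇝-mp x y = subst (_≤ y) (sym (div₃ x y)) (x⊙y≤x y (y ⇝ x))

  ⊙-monoʳ-≤ : ∀ x {y z} → y ≤ z → x ⊙ y ≤ x ⊙ z
  ⊙-monoʳ-≤ x {y} {z} y≤z = subst (_≤ x ⊙ z) xz⊙z⇝y≡xy (x⊙y≤x (x ⊙ z) (z ⇝ y))
    where
    xz⊙z⇝y≡xy : (x ⊙ z) ⊙ (z ⇝ y) ≡ x ⊙ y
    xz⊙z⇝y≡xy = trans (sym (⊙-assoc x z (z ⇝ y))) (cong (x ⊙_) (≤⇒⊙⇝≡ y≤z))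

  ⊙-monoˡ-≤ : ∀ x {y z} → y ≤ z → y ⊙ x ≤ z ⊙ x
  ⊙-monoˡ-≤ x {y} {z} y≤z = subst (_≤ z ⊙ x) z⇒y⊙zx≡yx (x⊙y≤y (z ⇒ y) (z ⊙ x))
    where
    z⇒y⊙zx≡yx : (z ⇒ y) ⊙ (z ⊙ x) ≡ y ⊙ x
    z⇒y⊙zx≡yx = trans (⊙-assoc (z ⇒ y) z x) (cong (_⊙ x) (≤⇒⇒⊙≡ y≤z))

  x≤x∨₁y : ∀ x y → x ≤ x ∨₁ y
  x≤x∨₁y x y = ⇝≡one⇒≤ (begin
    x ⇝ ((x ⇒ y) ⇝ y)     ≡⟨ sym (⇝-curry (x ⇒ y) x y) ⟩
    ((x ⇒ y) ⊙ x) ⇝ y     ≡⟨ ≤⇒⇝≡one (⇒-mp x y) ⟩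
    one                   ∎)

  x≤x∨₂y : ∀ x y → x ≤ x ∨₂ y
  x≤x∨₂y x y = begin
    x ⇒ ((x ⇝ y) ⇒ y)     ≡⟨ sym (⇒-curry x (x ⇝ y) y) ⟩
    (x ⊙ (x ⇝ y)) ⇒ y     ≡⟨ ⇝-mp x y ⟩
    one                   ∎

  ∨₁-⇒ : ∀ x y → (x ∨₁ y) ⇒ y ≡ x ⇒ y
  ∨₁-⇒ x y = ≤-antisym (trans (sym (⇒-curry d x y)) d⊙x≤y) (x≤x∨₂y (x ⇒ y) y)
    where
    d = (x ∨₁ y) ⇒ y
    d⊙x≤y : d ⊙ x ≤ y
    d⊙x≤y = ≤-trans (⊙-monoʳ-≤ d (x≤x∨₁y x y)) (⇒-mp (x ∨₁ y) y)

  ∨₂-⇝ : ∀ x y → (x ∨₂ y) ⇝ y ≡ x ⇝ y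
  ∨₂-⇝ x y = ≤-antisym (⇝≡one⇒≤ (trans (sym (⇝-curry x d y)) (≤⇒⇝≡one x⊙d≤y)))
                       (x≤x∨₁y (x ⇝ y) y)
    where
    d = (x ∨₂ y) ⇝ y
    x⊙d≤y : x ⊙ d ≤ y
    x⊙d≤y = ≤-trans (⊙-monoˡ-≤ d (x≤x∨₂y x y)) (⇝-mp (x ∨₂ y) y)

  id-isTypeIStateOperator : IsTypeIStateOperator A id
  id-isTypeIStateOperator =
      (λ x y → sym (∨₁-⇒ x y) , sym (∨₂-⇝ x y))
    , (λ x y → sym (≤⇒⊙⇝≡ (x⊙y≤x x y)) , sym (≤⇒⇒⊙≡ (x⊙y≤y x y)))
    , (λ x y → refl)
    , (λ x y → refl , refl)

  IS1'-id⇒isWajsberg : IS1' A id → IsWajsberg A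
  IS1'-id⇒isWajsberg is1' =
      (λ x y → ≤-antisym (y∨₁x≤x∨₁y y x) (y∨₁x≤x∨₁y x y))
    , (λ x y → ≤-antisym (y∨₂x≤x∨₂y y x) (y∨₂x≤x∨₂y x y))
    where
    y∨₁x≤x∨₁y : ∀ x y → y ∨₁ x ≤ x ∨₁ y
    y∨₁x≤x∨₁y x y = subst (λ t → y ∨₁ x ≤ t ⇝ y) (sym (proj₁ (is1' x y))) (x≤x∨₁y (y ∨₁ x) y)
    y∨₂x≤x∨₂y : ∀ x y → y ∨₂ x ≤ x ∨₂ y
    y∨₂x≤x∨₂y x y = subst (λ t → y ∨₂ x ≤ t ⇒ y) (sym (proj₂ (is1' x y))) (x≤x∨₂y (y ∨₂ x) y)

  isWajsberg⇒IS1⇔IS1' : IsWajsberg A → ∀ μ → IS1 A μ ⇔ IS1' A μ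
  isWajsberg⇒IS1⇔IS1' (∨₁-comm , ∨₂-comm) μ = mk⇔
    (λ is1 x y → trans (proj₁ (is1 x y)) (cong (λ t → μ t ⇒ μ y) (∨₁-comm x y))
               , trans (proj₂ (is1 x y)) (cong (λ t → μ t ⇝ μ y) (∨₂-comm x y)))
    (λ is1' x y → trans (proj₁ (is1' x y)) (cong (λ t → μ t ⇒ μ y) (∨₁-comm y x))
                , trans (proj₂ (is1' x y)) (cong (λ t → μ t ⇝ μ y) (∨₂-comm y x)))

proposition5p4 : ∀ {ℓ : Level} (A : PseudoHoop ℓ) →
    IsWajsberg A ⇔ (∀ (μ : PseudoHoop.Carrier A → PseudoHoop.Carrier A) →
    IsTypeIStateOperator A μ ⇔ IsTypeIIStateOperator A μ)
proposition5p4 A = mk⇔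
  (λ w μ → mk⇔ (map₁ (Equivalence.to (isWajsberg⇒IS1⇔IS1' w μ)))
               (map₁ (Equivalence.from (isWajsberg⇒IS1⇔IS1' w μ))))
  (λ typeI⇔typeII → IS1'-id⇒isWajsberg (proj₁ (Equivalence.to (typeI⇔typeII id) id-isTypeIStateOperator)))
  where open PseudoHoopProperties A
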